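{- Let $A$ be a setoid, $B$ a setoid family over $A$, and $(C,a_C)$ a $P_B$-algebra. The assignments $\mathsf{rest} : h\mapsto (\lambda w.\,h\circ m_w)$ and $F\mapsto a_C\circ(\mathsf{cmprh}\,F)$ are extensional functions $\mathsf{Alg}_B(\mathsf{s},a_C)\Rightarrow\mathsf{RFam}$ and $\mathsf{RFam}\Rightarrow\mathsf{Alg}_B(\mathsf{s},a_C)$ which are inverse to each other: for every $F$ in $\mathsf{RFam}$ and every $w:W$, $(a_C\circ(\mathsf{cmprh}\,F))\circ m_w\approx F\,w$; and for every algebra morphism $h$, $a_C\circ(\mathsf{cmprh}\,(\mathsf{rest}\,h))\approx h$.
   Context: Setting: intensional Martin-Löf type theory with $\Pi$-types and a universe $\mathsf{U}$ closed under $\Pi$ and containing intensional $\Sigma$-types, identity types, the unit type, W-types and dependent W-types (inductive families); logic is propositions-as-types. A setoid $X$ is a tuple $(X_0,\approx_X,r_X,s_X,t_X)$ with $X_0:\mathsf{U}$, $\approx_X:X_0\to X_0\to\mathsf{U}$ and witnesses of reflexivity, symmetry, transitivity; $x:X$ means $x:X_0$. An extensional function $f:X\Rightarrow Y$ is $f_0:X_0\to Y_0$ with a proof of $\prod_{x,x'}x\approx x'\to f_0x\approx f_0x'$; the setoid $X\Rightarrow Y$ has $f\approx g:=\prod_x f_0x\approx g_0x$. A setoid family $B$ over a setoid $A$ gives a setoid $B\,a$ (underlying type $B_0 a$) for $a:A$ and extensional transports $B_\alpha:B\,a\Rightarrow B\,a'$ for $\alpha:a\approx_A a'$, functorial up to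 $\approx$, with $B_\alpha\approx B_{\alpha'}$ for all $\alpha,\alpha':a\approx a'$. Write $b\approx_\alpha b'$ for $B_\alpha b\approx b'$. $P_B X$ is the setoid on $\sum_{a:A_0}(B\,a\Rightarrow X)$ with $(a,k)\approx(a',k'):=\sum_{\alpha:a\approx a'}k\approx k'\circ B_\alpha$, and $P_B f(a,k):=(a,f\circ k)$. A $P_B$-algebra is a setoid $C$ with extensional $a_C:P_BC\Rightarrow C$. $\mathrm{W}$ is the W-type on $A_0,B_0$ with constructor $\mathsf{sup}$, and $\mathsf{n}(\mathsf{sup}\,a\,f)\equiv a$, $\mathsf{b}(\mathsf{sup}\,a\,f)\equiv f$. $\mathcal{W}_B:\mathrm{W}\to\mathrm{W}\to\mathsf{U}$ is the inductive family with single constructor $\mathsf{dsup}\,(w,w')\,\alpha\,\phi:\mathcal{W}_B\,w\,w'$ for $\alpha:\mathsf{n}w\approx_A\mathsf{n}w'$ and $\phi:\prod_{(b,b',\beta):\sum_{b,b'}b\approx_\alpha b'}\mathcal{W}_B(\mathsf{b}\,w\,b)(\mathsf{b}\,w'\,b')$. The setoid $W$ has underlying type $\sum_w\mathcal{W}_B\,w\,w$ and $(w,\_)\approx_W(w',\_):=\mathcal{W}_B\,w\,w'$. For $\gamma:w\approx_W w'$, $\mathsf{n}\triangleright\gamma:\mathsf{n}w\approx_A\mathsf{n}w'$ denotes its label component; $\mathsf{n}:W\Rightarrow A$ and each $\mathsf{b}\,w:B(\mathsf{n}w)\Rightarrow W$ are extensional. $\mathsf{s}:P_BW\Rightarrow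 W$ sends $(a,f)$ to the tree $\mathsf{sup}\,a\,(\lambda b.\mathrm{pr}_1(f_0 b))$; $\mathsf{Alg}_B(\mathsf{s},a_C)$ is the setoid of $h:W\Rightarrow C$ with a proof of $h\circ\mathsf{s}\approx a_C\circ P_B h$, compared by $h\approx h'$ (algebra morphisms). Immediate subtrees: for $w:W$, $\mathsf{ImS}\,w$ is the setoid on $B_0(\mathsf{n}w)$ with $s\approx s':=\mathsf{b}\,w\,s\approx_W\mathsf{b}\,w\,s'$; for $\gamma:w\approx_W w'$, $\mathsf{ImS}_\gamma:=B_{\mathsf{n}\triangleright\gamma}:\mathsf{ImS}\,w\Rightarrow\mathsf{ImS}\,w'$. $e_w:B(\mathsf{n}w)\Rightarrow\mathsf{ImS}\,w$ is the identity on underlying types and $m_w:\mathsf{ImS}\,w\Rightarrow W$ has underlying function $\mathsf{b}\,w$. $\mathsf{CohMaps}\,w$ is the setoid of families $F:\prod_{s:\mathsf{ImS}\,w}\mathsf{ImS}(\mathsf{b}\,w\,s)\Rightarrow C$ such that $F\,s\approx(F\,s')\circ\mathsf{ImS}_\sigma$ for all $\sigma:\mathsf{b}\,w\,s\approx_W\mathsf{b}\,w\,s'$, with pointwise equality. For $F:\mathsf{CohMaps}\,w$, $\mathsf{recst}\,w\,F:\mathsf{ImS}\,w\Rightarrow C$ is $s\mapsto a_C(\mathsf{n}(\mathsf{b}\,w\,s),(F\,s)\circ e_{\mathsf{b} w s})$. For $w:W$ and $k:\mathsf{ImS}\,w\Rightarrow C$, $\mathsf{RecDef}\,w\,k$ is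 the inductive family (dependent W-type indexed by $\sum_{w:W}(\mathsf{ImS}\,w\Rightarrow C)$) with the single constructor: from $F:\mathsf{CohMaps}\,w$, a proof of $k\approx\mathsf{recst}\,w\,F$, and $\prod_{s:B_0(\mathsf{n}w)}\mathsf{RecDef}\,(\mathsf{b}\,w\,s)\,(F\,s)$, form an element of $\mathsf{RecDef}\,w\,k$. $k$ is called recursively defined if $\mathsf{RecDef}\,w\,k$ is inhabited. $\mathsf{RFam}$ is the setoid of pairs $(F,R)$ with $F:\prod_{w:W}\mathsf{ImS}\,w\Rightarrow C$ and $R:\prod_w\mathsf{RecDef}\,w\,(F\,w)$, with $(F,\_)\approx(F',\_):=\prod_w F\,w\approx F'\,w$. A family $F:\prod_w\mathsf{ImS}\,w\Rightarrow C$ is coherent if $F\,w\approx(F\,w')\circ\mathsf{ImS}_\gamma$ for all $\gamma:w\approx_W w'$; for coherent $F$, $\mathsf{cmprh}\,F:W\Rightarrow P_BC$ is $w\mapsto(\mathsf{n}\,w,(F\,w)\circ e_w)$ (first components of elements of $\mathsf{RFam}$ are coherent). -}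

module Defs where

open import Level using (0ℓ)
open import Data.Product using (Σ; _,_; proj₁; proj₂)
open import Relation.Binary.Bundles using (Setoid)
open import Function.Bundles using (Func)
open Func using (to; cong)

_∘F_ : {X Y Z : Setoid 0ℓ 0ℓ} → Func Y Z → Func X Y → Func X Z
to (g ∘F f) x = to g (to f x)
cong (g ∘F f) e = cong g (cong f e)

record Fam (A : Setoid 0ℓ 0ℓ) : Set₁ where
  open Setoid A
  field
    fib      : Carrier → Setoid 0ℓ 0ℓ
    tr       : ∀ {a a'} → a ≈ a' → Func (fib a) (fib a')
    tr-refl  : ∀ {a} (x : Setoid.Carrier (fib a)) →
               Setoid._≈_ (fib a) (to (tr refl) x) x
    tr-trans : ∀ {a a' a''} (α : a ≈ a') (β : a' ≈ a'') (x : Setoid.Carrier (fib a)) →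
               Setoid._≈_ (fib a'') (to (tr (trans α β)) x) (to (tr β) (to (tr α) x))
    tr-irr   : ∀ {a a'} (α α' : a ≈ a') (x : Setoid.Carrier (fib a)) →
               Setoid._≈_ (fib a') (to (tr α) x) (to (tr α') x)

  B₀ : Carrier → Set
  B₀ a = Setoid.Carrier (fib a)

  tr-id : ∀ {a} (α : a ≈ a) (x : B₀ a) → Setoid._≈_ (fib a) (to (tr α) x) x
  tr-id {a} α x = Setoid.trans (fib a) (tr-irr α refl x) (tr-refl x)

  tr-inv : ∀ {a a'} (α : a ≈ a') (y : B₀ a') →
           Setoid._≈_ (fib a') (to (tr α) (to (tr (sym α)) y)) y
  tr-inv {a} {a'} α y = Setoid.trans (fib a')
    (Setoid.sym (fib a') (tr-trans (sym α) α y)) (tr-id (trans (sym α) α) y)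

module _ {A : Setoid 0ℓ 0ℓ} (B : Fam A) where
  open Fam B
  private
    module A = Setoid A

  P : Setoid 0ℓ 0ℓ → Setoid 0ℓ 0ℓ
  P X = record
    { Carrier = Σ A.Carrier (λ a → Func (fib a) X)
    ; _≈_ = λ { (a , k) (a' , k') →
        Σ (a A.≈ a') (λ α → ∀ x → Setoid._≈_ X (to k x) (to k' (to (tr α) x))) }
    ; isEquivalence = record
      { refl = λ { {a , k} → A.refl , λ x → X.sym (cong k (tr-refl x)) }
      ; sym = λ { {a , k} {a' , k'} (α , p) → A.sym α , λ y →
          X.trans (X.sym (cong k' (tr-inv α y))) (X.sym (p (to (tr (A.sym α)) y))) }
      ; trans = λ { {a , k} {a' , k'} {a'' , k''} (α , p) (β , q) → A.trans α β , λ x →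
          X.trans (p x) (X.trans (q (to (tr α) x))
            (cong k'' (Setoid.sym (fib a'') (tr-trans α β x)))) }
      }
    }
    where module X = Setoid X

  Pmap : {X Y : Setoid 0ℓ 0ℓ} → Func X Y → Func (P X) (P Y)
  to (Pmap f) (a , k) = a , (f ∘F k)
  cong (Pmap f) (α , p) = α , λ x → cong f (p x)

data WT (A₀ : Set) (B₀ : A₀ → Set) : Set where
  sup : (a : A₀) → (B₀ a → WT A₀ B₀) → WT A₀ B₀

module WConstr (A : Setoid 0ℓ 0ℓ) (B : Fam A) where
  open Fam B public
  module A = Setoid A
  module Fb {a} = Setoid (fib a)

  W₀ : Set
  W₀ = WT A.Carrier B₀

  n : W₀ → A.Carrier
  n (sup a f) = a

  b : (w : W₀) → B₀ (n w) → W₀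
  b (sup a f) = f

  data 𝒲 : W₀ → W₀ → Set where
    dsup : ∀ {w w'} (α : n w A.≈ n w') →
           ((x : B₀ (n w)) (x' : B₀ (n w')) → to (tr α) x Fb.≈ x' → 𝒲 (b w x) (b w' x')) →
           𝒲 w w'

  label : ∀ {w w'} → 𝒲 w w' → n w A.≈ n w'
  label (dsup α φ) = α

  sub : ∀ {w w'} (γ : 𝒲 w w') (x : B₀ (n w)) (x' : B₀ (n w')) →
        to (tr (label γ)) x Fb.≈ x' → 𝒲 (b w x) (b w' x')
  sub (dsup α φ) = φ

  𝒲-sym : ∀ {w w'} → 𝒲 w w' → 𝒲 w' w
  𝒲-sym (dsup α φ) = dsup (A.sym α) λ x' x β →
    𝒲-sym (φ x x' (Fb.trans (cong (tr α) (Fb.sym β)) (tr-inv α x')))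

  𝒲-trans : ∀ {w w' w''} → 𝒲 w w' → 𝒲 w' w'' → 𝒲 w w''
  𝒲-trans (dsup α φ) (dsup β ψ) = dsup (A.trans α β) λ x x'' γ →
    𝒲-trans (φ x (to (tr α) x) Fb.refl)
            (ψ (to (tr α) x) x'' (Fb.trans (Fb.sym (tr-trans α β x)) γ))

  Wˢ : Setoid 0ℓ 0ℓ
  Wˢ = record
    { Carrier = Σ W₀ (λ w → 𝒲 w w)
    ; _≈_ = λ u v → 𝒲 (proj₁ u) (proj₁ v)
    ; isEquivalence = record
      { refl = λ { {w , p} → p } ; sym = 𝒲-sym ; trans = 𝒲-trans } }

  Wc : Set
  Wc = Setoid.Carrier Wˢ

  nW : Wc → A.Carrier
  nW w = n (proj₁ w)

  nF : Func Wˢ A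
  to nF = nW
  cong nF = label

  bF : (w : Wc) → Func (fib (nW w)) Wˢ
  to (bF (w , p)) x = b w x , sub p x x (tr-id (label p) x)
  cong (bF (w , p)) {x} {x'} e = sub p x x' (Fb.trans (tr-id (label p) x) e)

  bsub : (w : Wc) → B₀ (nW w) → Wc
  bsub w = to (bF w)

  s : Func (P B Wˢ) Wˢ
  to s (a , f) = sup a (λ x → proj₁ (to f x)) ,
    dsup A.refl (λ x x' β → cong f (Fb.trans (Fb.sym (tr-refl x)) β))
  cong s {a , f} {a' , f'} (α , p) = dsup α λ x x' β → 𝒲-trans (p x) (cong f' β)

  ImS : Wc → Setoid 0ℓ 0ℓ
  ImS w = record
    { Carrier = B₀ (nW w)
    ; _≈_ = λ x x' → 𝒲 (proj₁ (bsub w x)) (proj₁ (bsub w x'))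
    ; isEquivalence = record
      { refl = λ {x} → proj₂ (bsub w x) ; sym = 𝒲-sym ; trans = 𝒲-trans } }

  ImSγ : (w w' : Wc) → 𝒲 (proj₁ w) (proj₁ w') → Func (ImS w) (ImS w')
  to (ImSγ w w' γ) = to (tr (label γ))
  cong (ImSγ w w' γ) {x} {y} e =
    𝒲-trans (𝒲-sym (sub γ x _ Fb.refl)) (𝒲-trans e (sub γ y _ Fb.refl))

  e : (w : Wc) → Func (fib (nW w)) (ImS w)
  to (e w) x = x
  cong (e w) = cong (bF w)

  m : (w : Wc) → Func (ImS w) Wˢ
  to (m w) = bsub w
  cong (m w) q = q

module AlgConstr (A : Setoid 0ℓ 0ℓ) (B : Fam A)
                 (C : Setoid 0ℓ 0ℓ) (aC : Func (P B C) C) where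
  open WConstr A B public
  module C = Setoid C

  record CohMaps (w : Wc) : Set where
    field
      fam : (x : B₀ (nW w)) → Func (ImS (bsub w x)) C
      coh : ∀ x x' (σ : 𝒲 (proj₁ (bsub w x)) (proj₁ (bsub w x')))
              (y : B₀ (nW (bsub w x))) →
            to (fam x) y C.≈ to (fam x') (to (ImSγ (bsub w x) (bsub w x') σ) y)
  open CohMaps public

  recst : (w : Wc) → CohMaps w → Func (ImS w) C
  to (recst w F) x = to aC (nW (bsub w x) , (fam F x ∘F e (bsub w x)))
  cong (recst w F) {x} {x'} σ = cong aC (label σ , λ y → coh F x x' σ y)

  data RecDef : (w : Wc) → Func (ImS w) C → Set where
    recdef : ∀ {w k} (F : CohMaps w) →
             (∀ x → to k x C.≈ to (recst w F) x) →
             ((x : B₀ (nW w)) → RecDef (bsub w x) (fam F x)) →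
             RecDef w k

  AlgS : Setoid 0ℓ 0ℓ
  AlgS = record
    { Carrier = Σ (Func Wˢ C) (λ h →
        (z : Setoid.Carrier (P B Wˢ)) → to h (to s z) C.≈ to aC (to (Pmap B h) z))
    ; _≈_ = λ h h' → ∀ w → to (proj₁ h) w C.≈ to (proj₁ h') w
    ; isEquivalence = record
      { refl = λ w → C.refl
      ; sym = λ p w → C.sym (p w)
      ; trans = λ p q w → C.trans (p w) (q w) } }

  RFam : Setoid 0ℓ 0ℓ
  RFam = record
    { Carrier = Σ ((w : Wc) → Func (ImS w) C) (λ F → (w : Wc) → RecDef w (F w))
    ; _≈_ = λ F F' → ∀ w x → to (proj₁ F w) x C.≈ to (proj₁ F' w) x
    ; isEquivalence = record
      { refl = λ w x → C.refl
      ; sym = λ p w x → C.sym (p w x)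
      ; trans = λ p q w x → C.trans (p w x) (q w x) } }

  restFun : Setoid.Carrier AlgS → (w : Wc) → Func (ImS w) C
  restFun h w = proj₁ h ∘F m w

  cmprh₀ : ((w : Wc) → Func (ImS w) C) → Wc → Setoid.Carrier (P B C)
  cmprh₀ F w = nW w , (F w ∘F e w)

  backFun : Setoid.Carrier RFam → Wc → C.Carrier
  backFun F w = to aC (cmprh₀ (proj₁ F) w)

module Submission where

open import Defs
open import Level using (0ℓ)
open import Data.Product using (Σ; _×_; _,_; proj₁; proj₂)
open import Relation.Binary.Bundles using (Setoid)
open import Relation.Binary.PropositionalEquality using (_≡_; refl)
open import Function.Bundles using (Func)
open Func using (to; cong)

-- Going forth, an algebra morphism h unfolds at every tree w as
-- h w ≈ a_C (n w , h ∘ m_w ∘ e_w), because w ≈ s (n w , b w) (η-law for W);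
-- applying this to all subtrees shows that the restrictions h ∘ m_w form a
-- recursively defined family.  Going back, the key fact is that
-- recursively defined maps are unique: two of them agree on any pair of
-- bisimilar subtrees (induction on the RecDef witnesses).  Hence every
-- family in RFam is coherent, so cmprh F is extensional and
-- a_C ∘ cmprh F is an algebra morphism, and unfolding a RecDef witness once
-- more yields (a_C ∘ cmprh F) ∘ m_w ≈ F w.  The other round trip is
-- exactly the unfolding of morphisms.

P-pointwise : {A : Setoid 0ℓ 0ℓ} (B : Fam A) (X : Setoid 0ℓ 0ℓ) {a : Setoid.Carrier A}
              (k k' : Func (Fam.fib B a) X) →
              (∀ x → Setoid._≈_ X (to k x) (to k' x)) →
              Setoid._≈_ (P B X) (a , k) (a , k')
P-pointwise {A} B X k k' k≈k' =
  Setoid.refl A , λ x → X.trans (k≈k' x) (cong k' (Fb.sym (Fam.tr-refl B x)))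
  where
    module X = Setoid X
    module Fb {a} = Setoid (Fam.fib B a)

module Construction (A : Setoid 0ℓ 0ℓ) (B : Fam A)
                    (C : Setoid 0ℓ 0ℓ) (aC : Func (P B C) C) where
  open AlgConstr A B C aC

  sup-η : (w : Wc) → 𝒲 (proj₁ w) (proj₁ (to s (nW w , bF w)))
  sup-η (sup a f , w≈w) = w≈w

  morphism-unfold : (h : Setoid.Carrier AlgS) (w : Wc) →
                    to (proj₁ h) w C.≈ to aC (nW w , (restFun h w ∘F e w))
  morphism-unfold (h , h-mor) w = C.trans (cong h (sup-η w))
    (C.trans (h-mor (nW w , bF w))
             (cong aC (P-pointwise B C (h ∘F bF w) (restFun (h , h-mor) w ∘F e w)
                                   (λ x → C.refl))))

  Coherent : ((w : Wc) → Func (ImS w) C) → Set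
  Coherent F = ∀ w w' (γ : 𝒲 (proj₁ w) (proj₁ w')) (x : B₀ (nW w)) →
               to (F w) x C.≈ to (F w') (to (ImSγ w w' γ) x)

  cmprh : (F : (w : Wc) → Func (ImS w) C) → Coherent F → Func Wˢ (P B C)
  to (cmprh F F-coh) = cmprh₀ F
  cong (cmprh F F-coh) {w} {w'} γ = label γ , F-coh w w' γ

  recdef-agree : ∀ {u u' k k'} → RecDef u k → RecDef u' k' → ∀ y y' →
                 𝒲 (proj₁ (bsub u y)) (proj₁ (bsub u' y')) → to k y C.≈ to k' y'
  recdef-agree (recdef _ k≈ G-rec) (recdef _ k'≈ G'-rec) y y' σ =
    C.trans (k≈ y) (C.trans
      (cong aC (label σ , λ t →
        recdef-agree (G-rec y) (G'-rec y') t _ (sub σ t _ Fb.refl)))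
      (C.sym (k'≈ y')))

  recdef-unfold : ∀ {u v k k'} → RecDef u k → RecDef v k' → ∀ y →
                  𝒲 (proj₁ (bsub u y)) (proj₁ v) →
                  to k y C.≈ to aC (nW v , (k' ∘F e v))
  recdef-unfold (recdef _ k≈ G-rec) k'-rec y σ = C.trans (k≈ y)
    (cong aC (label σ , λ t → recdef-agree (G-rec y) k'-rec t _ (sub σ t _ Fb.refl)))

  restriction-coherent : (h : Setoid.Carrier AlgS) → Coherent (restFun h)
  restriction-coherent h w w' γ x = cong (proj₁ h) (sub γ x _ Fb.refl)

  restriction-recdef : (h : Setoid.Carrier AlgS) (w : Wc) → RecDef w (restFun h w)
  restriction-recdef h (w₀ , w₀≈w₀) = onTree w₀ w₀≈w₀
    where
      subtreeRestrictions : (w : Wc) → CohMaps w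
      fam (subtreeRestrictions w) x = restFun h (bsub w x)
      coh (subtreeRestrictions w) x x' = restriction-coherent h (bsub w x) (bsub w x')

      onTree : (w₀ : W₀) (w₀≈w₀ : 𝒲 w₀ w₀) → RecDef (w₀ , w₀≈w₀) (restFun h (w₀ , w₀≈w₀))
      onTree (sup a f) w₀≈w₀ =
        recdef (subtreeRestrictions w)
          (λ x → morphism-unfold h (bsub w x))
          (λ x → onTree (f x) (proj₂ (bsub w x)))
        where
          w : Wc
          w = sup a f , w₀≈w₀

  rest : Func AlgS RFam
  to rest h = restFun h , restriction-recdef h
  cong rest h≈h' w x = h≈h' (bsub w x)

  rfam-coherent : (F : Setoid.Carrier RFam) → Coherent (proj₁ F)
  rfam-coherent (F , F-rec) w w' γ x =
    recdef-agree (F-rec w) (F-rec w') x _ (sub γ x _ Fb.refl)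

  backMap : Setoid.Carrier RFam → Func Wˢ C
  backMap F = aC ∘F cmprh (proj₁ F) (rfam-coherent F)

  back-morphism : (F : Setoid.Carrier RFam) (z : Setoid.Carrier (P B Wˢ)) →
                  to (backMap F) (to s z) C.≈ to aC (to (Pmap B (backMap F)) z)
  back-morphism (F , F-rec) (a , f) = cong aC (A.refl , λ x →
    recdef-unfold (F-rec (to s (a , f))) (F-rec (to f (to (tr A.refl) x))) x
                  (cong f (Fb.sym (tr-refl x))))

  back : Func RFam AlgS
  to back F = backMap F , back-morphism F
  cong back {F} {F'} F≈F' w =
    cong aC (P-pointwise B C (proj₁ F w ∘F e w) (proj₁ F' w ∘F e w) (F≈F' w))

  back-then-rest : ∀ F w x → to (proj₁ (to back F)) (to (m w) x) C.≈ to (proj₁ F w) x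
  back-then-rest (F , F-rec) w x =
    C.sym (recdef-unfold (F-rec w) (F-rec (bsub w x)) x (proj₂ (bsub w x)))

  rest-then-back : ∀ h w → to (proj₁ (to back (to rest h))) w C.≈ to (proj₁ h) w
  rest-then-back h w = C.sym (morphism-unfold h w)

theorem3p17 : (A : Setoid 0ℓ 0ℓ) (B : Fam A) (C : Setoid 0ℓ 0ℓ) (aC : Func (P B C) C) →
    let open AlgConstr A B C aC in
    Σ (Func AlgS RFam) λ rest →
    Σ (Func RFam AlgS) λ back →
      (∀ h w x → Func.to (proj₁ (Func.to rest h) w) x ≡ Func.to (restFun h w) x)
      × (∀ F w → Func.to (proj₁ (Func.to back F)) w ≡ backFun F w)
      × (∀ F w x → Func.to (proj₁ (Func.to back F)) (Func.to (m w) x) C.≈ Func.to (proj₁ F w) x)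
      × (∀ h w → Func.to (proj₁ (Func.to back (Func.to rest h))) w C.≈ Func.to (proj₁ h) w)
theorem3p17 A B C aC =
  rest , back , (λ h w x → refl) , (λ F w → refl) , back-then-rest , rest-then-back
  where open Construction A B C aC
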